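{- Let $P$ be a finite $(3+1)$-free poset, and let $a,b,c,d\in P$ induce a $(2+2)$ subposet with $a<_Pc$ and $b<_Pd$ (so $a$ is incomparable with $b$ and $d$, and $b$ is incomparable with $c$). Let $V_1,V_2\subseteq P$ be such that the pair $(V_1,V_2)$ satisfies: (a) $a,b\in V_1$ and $c,d\in V_2$; (b) the elements of $V_1$ are pairwise incomparable, and the elements of $V_2$ are pairwise incomparable; (c) for every nonempty $A\subsetneq V_1$ there is an induced $(2+2)$ subposet with one element in $A$, one in $V_1\setminus A$, and two in $V_2$; (d) for every nonempty $B\subsetneq V_2$ there is an induced $(2+2)$ subposet with one element in $B$, one in $V_2\setminus B$, and two in $V_1$; (e) for every $x\in V_1$ and $y\in V_2$, either $x<_Py$ or $x$ and $y$ are incomparable; and suppose $(V_1,V_2)$ is maximal with respect to inclusion among pairs satisfying (a)–(e) (there is no other pair $(V_1',V_2')$ satisfying (a)–(e) with $V_1\subseteq V_1'$ and $V_2\subseteq V_2'$). Then $V_1$ and $V_2$ form a homogeneous pair of cliques in the incomparability graph of $P$; that is, in addition: (f) every $v\in P\setminus(V_1\cup V_2)$ is either comparable to every element of $V_1$ or incomparable with every element of $V_1$, and likewise either comparable to every element of $V_2$ or incomparable with every element of $V_2$.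
   Context: The $(3+1)$ poset has elements $a,b,c,d$ with $a<b<c$ and $d$ incomparable to $a,b,c$; the $(2+2)$ poset has elements $a,b,c,d$ with $a<c$, $b<d$ and no other strict relations. A poset is $Q$-free if it has no induced subposet isomorphic to $Q$. The incomparability graph of a poset has the same elements as vertices, two distinct elements adjacent iff they are incomparable. -}

module Defs where

open import Level using (0ℓ)
open import Data.Nat using (ℕ)
open import Data.Fin using (Fin)
open import Data.Fin.Subset using (Subset; _∈_; _∉_; _⊆_; _⊂_; _─_; Nonempty)
open import Data.List using (List; []; _∷_)
open import Data.List.Relation.Binary.Permutation.Propositional using (_↭_)
open import Data.Product using (Σ; ∃; _×_)
open import Data.Sum using (_⊎_)
open import Relation.Nullary using (¬_)
open import Relation.Binary.Definitions using (Decidable)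
open import Relation.Binary.Structures using (IsStrictPartialOrder)
open import Relation.Binary.PropositionalEquality using (_≡_; _≢_)

record FinPoset (n : ℕ) : Set₁ where
  field
    _<_     : Fin n → Fin n → Set
    isSPO   : IsStrictPartialOrder _≡_ _<_
    _<?_    : Decidable _<_

module _ {n : ℕ} (P : FinPoset n) where
  open FinPoset P

  Comp : Fin n → Fin n → Set
  Comp x y = x < y ⊎ y < x

  Inc : Fin n → Fin n → Set
  Inc x y = x ≢ y × ¬ (x < y) × ¬ (y < x)

  Is22 : Fin n → Fin n → Fin n → Fin n → Set
  Is22 p q r s = p < r × q < s × Inc p q × Inc p s × Inc q r × Inc r s

  Is31 : Fin n → Fin n → Fin n → Fin n → Set
  Is31 x y z u = x < y × y < z × Inc u x × Inc u y × Inc u z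

  ThreeOneFree : Set
  ThreeOneFree = ∀ x y z u → ¬ Is31 x y z u

  -- the four elements x,y,z,w (as a set) induce a (2+2) subposet
  Induces22 : Fin n → Fin n → Fin n → Fin n → Set
  Induces22 x y z w = ∃ λ p → ∃ λ q → ∃ λ r → ∃ λ s →
    Is22 p q r s × ((p ∷ q ∷ r ∷ s ∷ []) ↭ (x ∷ y ∷ z ∷ w ∷ []))

  Antichain : Subset n → Set
  Antichain V = ∀ x y → x ∈ V → y ∈ V → ¬ (x < y)

  Split22 : Subset n → Subset n → Set
  Split22 V W = ∀ (A : Subset n) → Nonempty A → A ⊂ V →
    ∃ λ x → ∃ λ y → ∃ λ z → ∃ λ w →
      x ∈ A × y ∈ (V ─ A) × z ∈ W × w ∈ W × Induces22 x y z w

  Good : (a b c d : Fin n) → Subset n → Subset n → Set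
  Good a b c d V₁ V₂ =
    (a ∈ V₁ × b ∈ V₁ × c ∈ V₂ × d ∈ V₂)
    × (Antichain V₁ × Antichain V₂)
    × Split22 V₁ V₂
    × Split22 V₂ V₁
    × (∀ x y → x ∈ V₁ → y ∈ V₂ → x < y ⊎ (x ≢ y × ¬ (x < y) × ¬ (y < x)))

  MaximalGood : (a b c d : Fin n) → Subset n → Subset n → Set
  MaximalGood a b c d V₁ V₂ = Good a b c d V₁ V₂ ×
    (∀ V₁' V₂' → Good a b c d V₁' V₂' → V₁ ⊆ V₁' → V₂ ⊆ V₂' →
       V₁' ≡ V₁ × V₂' ≡ V₂)

  Homogeneous : Fin n → Subset n → Set
  Homogeneous v V = (∀ x → x ∈ V → Comp v x) ⊎ (∀ x → x ∈ V → Inc v x)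

  HomogeneousPair : Subset n → Subset n → Set
  HomogeneousPair V₁ V₂ = ∀ v → v ∉ V₁ → v ∉ V₂ →
    Homogeneous v V₁ × Homogeneous v V₂

-- Let v lie outside V₁ ∪ V₂ and suppose v is comparable to some but not all
-- elements of V₁. Condition (c), applied to the elements of V₁ comparable to v,
-- yields a 2+2 with x < r and y < s, where x, y ∈ V₁, r, s ∈ V₂, v is comparable
-- to x and incomparable to y. If v < x, then v < x < r together with y is a 3+1.
-- If x < v, then v is incomparable to all of V₂: for u ∈ V₂, v < u would make
-- x < v < u with s a 3+1, and u < v would make p < u < v with y a 3+1, where p is
-- an element of V₁ below u supplied by condition (d). Hence (V₁, V₂ ∪ {v}) still
-- satisfies (a)–(e), the new element being tied to V₂ by the 2+2 x < v, y < s,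
-- which contradicts maximality. The claim for V₂ is the same argument in the
-- dual poset, where V₁ and V₂ exchange roles.

module Submission where

open import Defs
open import Level using (0ℓ)
open import Data.Nat using (ℕ)
open import Data.Fin using (Fin)
open import Data.Fin.Properties using (any?) renaming (_≟_ to _≟ᶠ_)
open import Data.Fin.Subset using (Subset; Nonempty; _∈_; _∉_; _⊆_; _─_; _∪_; _∩_; ⁅_⁆; outside)
open import Data.Fin.Subset.Properties
  using (_∈?_; nonempty?; x∈p∪q⁺; x∈p∪q⁻; x∈p∩q⁺; x∈p∩q⁻; x∈⁅x⁆; x≢y⇒x∉⁅y⁆; x∈⁅y⁆⇒x≡y; x∈p∧x∉q⇒x∈p─q; p─q⊆p; p⊆p∪q; q⊆p∪q)
open import Data.Vec.Base using (_∷_; here; there; tabulate)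
open import Data.Vec.Properties using (lookup∘tabulate; lookup⇒[]=; []=⇒lookup)
open import Data.List.Base using ([]) renaming (_∷_ to _∷ˡ_)
open import Data.List.Membership.Propositional using () renaming (_∈_ to _∈ˡ_)
open import Data.List.Relation.Unary.Any using () renaming (here to hereˡ; there to thereˡ)
open import Data.List.Relation.Unary.All using (All) renaming ([] to []ᵃ; _∷_ to _∷ᵃ_)
open import Data.List.Relation.Binary.Permutation.Propositional using (_↭_; ↭-refl; ↭-sym; ↭-trans; ↭-swap)
open import Data.List.Relation.Binary.Permutation.Propositional.Properties using (All-resp-↭; ∈-resp-↭; ++-comm)
open import Data.Product using (∃; ∃₂; _×_; _,_; proj₁; proj₂; swap)
open import Data.Sum using (_⊎_; inj₁; inj₂)
import Data.Sum as Sum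
open import Data.Empty using (⊥; ⊥-elim)
open import Function using (_∘_; flip; id)
open import Relation.Nullary using (¬_; Dec; yes; no; does)
open import Relation.Nullary.Decidable using (_×-dec_; _⊎-dec_; ¬?; decidable-stable; dec-true)
open import Relation.Unary using (Pred; Decidable)
open import Relation.Binary.Structures using (IsStrictPartialOrder)
import Relation.Binary.Construct.Flip.EqAndOrd as Flip
open import Relation.Binary.PropositionalEquality using (_≡_; _≢_; refl; sym; subst) renaming (trans to ≡-trans)

filter : ∀ {n} {Q : Pred (Fin n) 0ℓ} → Decidable Q → Subset n
filter Q? = tabulate (does ∘ Q?)

∈-filter⁺ : ∀ {n} {Q : Pred (Fin n) 0ℓ} (Q? : Decidable Q) {x} → Q x → x ∈ filter Q?
∈-filter⁺ Q? {x} qx = lookup⇒[]= x _ (≡-trans (lookup∘tabulate _ x) (dec-true (Q? x) qx))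

∈-filter⁻ : ∀ {n} {Q : Pred (Fin n) 0ℓ} (Q? : Decidable Q) {x} → x ∈ filter Q? → Q x
∈-filter⁻ Q? {x} x∈ with Q? x | ≡-trans (sym (lookup∘tabulate (does ∘ Q?) x)) ([]=⇒lookup x∈)
... | yes qx | _ = qx
... | no _ | ()

x∈p─q⇒x∉q : ∀ {n} {p q : Subset n} {x} → x ∈ p ─ q → x ∉ q
x∈p─q⇒x∉q {p = _ ∷ _} {outside ∷ _} here ()
x∈p─q⇒x∉q {p = _ ∷ _} {_ ∷ _} (there x∈) (there x∈q) = x∈p─q⇒x∉q x∈ x∈q

x∈p∪⁅y⁆⁻ : ∀ {n} {V : Subset n} {v u} → u ∈ V ∪ ⁅ v ⁆ → u ∈ V ⊎ u ≡ v
x∈p∪⁅y⁆⁻ {V = V} {v} u∈ with x∈p∪q⁻ V ⁅ v ⁆ u∈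
... | inj₁ u∈V    = inj₁ u∈V
... | inj₂ u∈⁅v⁆ = inj₂ (x∈⁅y⁆⇒x≡y v u∈⁅v⁆)

x∉p∧y∈p⇒x≢y : ∀ {n} {p : Subset n} {x y} → x ∉ p → y ∈ p → x ≢ y
x∉p∧y∈p⇒x≢y x∉p y∈p refl = x∉p y∈p

x∈p∧x∉q⇒x∈p∪r─q : ∀ {n} {p q : Subset n} (r : Subset n) {x} → x ∈ p → x ∉ q → x ∈ (p ∪ r) ─ q
x∈p∧x∉q⇒x∈p∪r─q r x∈p x∉q = x∈p∧x∉q⇒x∈p─q (x∈p∪q⁺ (inj₁ x∈p)) x∉q

module _ {n : ℕ} (P : FinPoset n) where
  open FinPoset P

  Inc-sym : ∀ {x y} → Inc P x y → Inc P y x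
  Inc-sym (x≢y , x≮y , y≮x) = x≢y ∘ sym , y≮x , x≮y

  ¬Comp⇒Inc : ∀ {x y} → x ≢ y → ¬ Comp P x y → Inc P x y
  ¬Comp⇒Inc x≢y ¬x∼y = x≢y , ¬x∼y ∘ inj₁ , ¬x∼y ∘ inj₂

  Comp? : ∀ x y → Dec (Comp P x y)
  Comp? x y = (x <? y) ⊎-dec (y <? x)

  Induces22-resp-↭ : ∀ {x y z w x′ y′ z′ w′} →
    (x ∷ˡ y ∷ˡ z ∷ˡ w ∷ˡ []) ↭ (x′ ∷ˡ y′ ∷ˡ z′ ∷ˡ w′ ∷ˡ []) →
    Induces22 P x y z w → Induces22 P x′ y′ z′ w′
  Induces22-resp-↭ σ (p , q , r , s , I , π) = p , q , r , s , I , ↭-trans π σ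

  Is22-swap : ∀ {p q r s} → Is22 P p q r s → Is22 P q p s r
  Is22-swap (p<r , q<s , p∥q , p∥s , q∥r , r∥s) = q<s , p<r , Inc-sym p∥q , q∥r , p∥s , Inc-sym r∥s

  Is22⇒Induces22 : ∀ {p q r s} → Is22 P p q r s → Induces22 P p q r s
  Is22⇒Induces22 I = _ , _ , _ , _ , I , ↭-refl

  Crossing22 : Subset n → Subset n → Subset n → Set
  Crossing22 V W A = ∃ λ x → ∃ λ y → ∃ λ z → ∃ λ w →
    x ∈ A × y ∈ (V ─ A) × z ∈ W × w ∈ W × Induces22 P x y z w

  Split22-monoʳ : ∀ {V W W′} → W ⊆ W′ → Split22 P V W → Split22 P V W′
  Split22-monoʳ W⊆W′ split A A≢∅ A⊂V with split A A≢∅ A⊂V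
  ... | x , y , z , w , x∈A , y∈V─A , z∈W , w∈W , I =
    x , y , z , w , x∈A , y∈V─A , W⊆W′ z∈W , W⊆W′ w∈W , I

  Split22-separates : ∀ {V W} {Q : Pred (Fin n) 0ℓ} → Split22 P V W → Decidable Q →
    (∀ x → x ∈ V → Q x) ⊎ (∀ x → x ∈ V → ¬ Q x) ⊎
    ∃₂ λ x y → ∃₂ λ z w →
      x ∈ V × y ∈ V × Q x × ¬ Q y × z ∈ W × w ∈ W × Induces22 P x y z w
  Split22-separates {V} {W} {Q} split Q?
    with any? (λ x → x ∈? V ×-dec ¬? (Q? x)) | any? (λ x → x ∈? V ×-dec Q? x)
  ... | no ∄¬Q | _ = inj₁ λ x x∈V → decidable-stable (Q? x) (λ ¬Qx → ∄¬Q (x , x∈V , ¬Qx))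
  ... | yes _ | no ∄Q = inj₂ (inj₁ λ x x∈V Qx → ∄Q (x , x∈V , Qx))
  ... | yes (x₁ , x₁∈V , ¬Qx₁) | yes (x₂ , x₂∈V , Qx₂) = inj₂ (inj₂ separating)
    where
    InV∧Q? : Decidable (λ x → x ∈ V × Q x)
    InV∧Q? x = x ∈? V ×-dec Q? x
    A = filter InV∧Q?
    separating : ∃₂ λ x y → ∃₂ λ z w →
      x ∈ V × y ∈ V × Q x × ¬ Q y × z ∈ W × w ∈ W × Induces22 P x y z w
    separating with split A (x₂ , ∈-filter⁺ InV∧Q? (x₂∈V , Qx₂))
                      (proj₁ ∘ ∈-filter⁻ InV∧Q? , x₁ , x₁∈V , ¬Qx₁ ∘ proj₂ ∘ ∈-filter⁻ InV∧Q?)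
    ... | x , y , z , w , x∈A , y∈V─A , z∈W , w∈W , I =
      let y∈V = p─q⊆p V A y∈V─A in
      x , y , z , w , proj₁ (∈-filter⁻ InV∧Q? x∈A) , y∈V , proj₂ (∈-filter⁻ InV∧Q? x∈A) ,
      (λ Qy → x∈p─q⇒x∉q y∈V─A (∈-filter⁺ InV∧Q? (y∈V , Qy))) , z∈W , w∈W , I

  Split22-∪⁅⁆ : ∀ {V W v k z w} → Split22 P V W → v ∉ V → k ∈ V → z ∈ W → w ∈ W →
    Induces22 P v k z w → Split22 P (V ∪ ⁅ v ⁆) W
  Split22-∪⁅⁆ {V} {W} {v} {k} {z} {w} split v∉V k∈V z∈W w∈W Ivk B B≢∅ (B⊆V∪v , u , u∈V∪v , u∉B)
    with v ∈? B
  ... | yes v∈B = cut-at-v (nonempty? (B ∩ V))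
    where
    cut-at-v : Dec (Nonempty (B ∩ V)) → Crossing22 (V ∪ ⁅ v ⁆) W B
    cut-at-v (no B∩V≡∅) =
      v , k , z , w , v∈B ,
      x∈p∧x∉q⇒x∈p∪r─q ⁅ v ⁆ k∈V (λ k∈B → B∩V≡∅ (k , x∈p∩q⁺ (k∈B , k∈V))) , z∈W , w∈W , Ivk
    cut-at-v (yes B∩V≢∅)
      with split (B ∩ V) B∩V≢∅ (proj₂ ∘ x∈p∩q⁻ B V , u , u∈V , u∉B ∘ proj₁ ∘ x∈p∩q⁻ B V)
      where
      u∈V : u ∈ V
      u∈V with x∈p∪⁅y⁆⁻ u∈V∪v
      ... | inj₁ u∈V = u∈V
      ... | inj₂ refl = ⊥-elim (u∉B v∈B)
    ... | x , y , z′ , w′ , x∈B∩V , y∈V─B∩V , z′∈W , w′∈W , I =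
      let y∈V = p─q⊆p V (B ∩ V) y∈V─B∩V in
      x , y , z′ , w′ , proj₁ (x∈p∩q⁻ B V x∈B∩V) ,
      x∈p∧x∉q⇒x∈p∪r─q ⁅ v ⁆ y∈V (λ y∈B → x∈p─q⇒x∉q y∈V─B∩V (x∈p∩q⁺ (y∈B , y∈V))) ,
      z′∈W , w′∈W , I
  ... | no v∉B = cut-inside-V (any? (λ t → t ∈? V ×-dec ¬? (t ∈? B)))
    where
    B⊆V : B ⊆ V
    B⊆V t∈B with x∈p∪⁅y⁆⁻ (B⊆V∪v t∈B)
    ... | inj₁ t∈V = t∈V
    ... | inj₂ refl = ⊥-elim (v∉B t∈B)
    cut-inside-V : Dec (∃ λ t → t ∈ V × t ∉ B) → Crossing22 (V ∪ ⁅ v ⁆) W B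
    cut-inside-V (no V⊆B) =
      k , v , z , w , decidable-stable (k ∈? B) (λ k∉B → V⊆B (k , k∈V , k∉B)) ,
      x∈p∧x∉q⇒x∈p─q (x∈p∪q⁺ (inj₂ (x∈⁅x⁆ v))) v∉B , z∈W , w∈W ,
      Induces22-resp-↭ (↭-swap v k ↭-refl) Ivk
    cut-inside-V (yes V⊈B) with split B B≢∅ (B⊆V , V⊈B)
    ... | x , y , z′ , w′ , x∈B , y∈V─B , z′∈W , w′∈W , I =
      x , y , z′ , w′ , x∈B , x∈p∧x∉q⇒x∈p∪r─q ⁅ v ⁆ (p─q⊆p V B y∈V─B) (x∈p─q⇒x∉q y∈V─B) ,
      z′∈W , w′∈W , I

_ᵒᵖ : ∀ {n} → FinPoset n → FinPoset n
P ᵒᵖ = record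
  { _<_   = flip _<_
  ; isSPO = Flip.isStrictPartialOrder isSPO
  ; _<?_  = flip _<?_
  }
  where open FinPoset P

Inc-ᵒᵖ : ∀ {n} (P : FinPoset n) {x y} → Inc P x y → Inc (P ᵒᵖ) x y
Inc-ᵒᵖ P (x≢y , x≮y , y≮x) = x≢y , y≮x , x≮y

module _ {n : ℕ} (P : FinPoset n) where
  open FinPoset P

  Is22-ᵒᵖ : ∀ {p q r s} → Is22 P p q r s → Is22 (P ᵒᵖ) r s p q
  Is22-ᵒᵖ (p<r , q<s , p∥q , p∥s , q∥r , r∥s) =
    p<r , q<s , Inc-ᵒᵖ P r∥s , Inc-ᵒᵖ P (Inc-sym P q∥r) , Inc-ᵒᵖ P (Inc-sym P p∥s) , Inc-ᵒᵖ P p∥q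

  Induces22-ᵒᵖ : ∀ {x y z w} → Induces22 P x y z w → Induces22 (P ᵒᵖ) x y z w
  Induces22-ᵒᵖ (p , q , r , s , I , π) =
    r , s , p , q , Is22-ᵒᵖ I , ↭-trans (++-comm (r ∷ˡ s ∷ˡ []) (p ∷ˡ q ∷ˡ [])) π

  Good-ᵒᵖ : ∀ {a b c d V₁ V₂} → Good P a b c d V₁ V₂ → Good (P ᵒᵖ) c d a b V₂ V₁
  Good-ᵒᵖ {V₁ = V₁} {V₂} ((a∈ , b∈ , c∈ , d∈) , (antichain₁ , antichain₂) , split₁₂ , split₂₁ , upward) =
    (c∈ , d∈ , a∈ , b∈) , ((λ x y x∈ y∈ → antichain₂ y x y∈ x∈) , (λ x y x∈ y∈ → antichain₁ y x y∈ x∈)) ,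
    Split22-ᵒᵖ split₂₁ , Split22-ᵒᵖ split₁₂ , downward
    where
    Split22-ᵒᵖ : ∀ {V W} → Split22 P V W → Split22 (P ᵒᵖ) V W
    Split22-ᵒᵖ split A A≢∅ A⊂V with split A A≢∅ A⊂V
    ... | x , y , z , w , x∈A , y∈V─A , z∈W , w∈W , I =
      x , y , z , w , x∈A , y∈V─A , z∈W , w∈W , Induces22-ᵒᵖ I
    downward : ∀ y x → y ∈ V₂ → x ∈ V₁ → x < y ⊎ Inc (P ᵒᵖ) y x
    downward y x y∈V₂ x∈V₁ with upward x y x∈V₁ y∈V₂
    ... | inj₁ x<y  = inj₁ x<y
    ... | inj₂ x∥y = inj₂ (Inc-ᵒᵖ P (Inc-sym P x∥y))

  ThreeOneFree-ᵒᵖ : ThreeOneFree P → ThreeOneFree (P ᵒᵖ)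
  ThreeOneFree-ᵒᵖ no31 x y z u (y<x , z<y , u∥x , u∥y , u∥z) =
    no31 z y x u (z<y , y<x , Inc-ᵒᵖ (P ᵒᵖ) u∥z , Inc-ᵒᵖ (P ᵒᵖ) u∥y , Inc-ᵒᵖ (P ᵒᵖ) u∥x)

  Homogeneous-ᵒᵖ : ∀ {v V} → Homogeneous (P ᵒᵖ) v V → Homogeneous P v V
  Homogeneous-ᵒᵖ (inj₁ all-comp) = inj₁ λ x x∈V → Sum.swap (all-comp x x∈V)
  Homogeneous-ᵒᵖ (inj₂ all-inc) = inj₂ λ x x∈V → Inc-ᵒᵖ (P ᵒᵖ) (all-inc x x∈V)

MaximalGood-ᵒᵖ : ∀ {n} (P : FinPoset n) {a b c d V₁ V₂} → MaximalGood P a b c d V₁ V₂ → MaximalGood (P ᵒᵖ) c d a b V₂ V₁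
MaximalGood-ᵒᵖ P (good , maximal) =
  Good-ᵒᵖ P good , λ V₂′ V₁′ good′ V₂⊆ V₁⊆ → swap (maximal V₁′ V₂′ (Good-ᵒᵖ (P ᵒᵖ) good′) V₁⊆ V₂⊆)

module GoodPair {n : ℕ} (P : FinPoset n) {a b c d : Fin n} {V₁ V₂ : Subset n}
                (good : Good P a b c d V₁ V₂) where
  open FinPoset P
  open IsStrictPartialOrder isSPO using (irrefl; asym) renaming (trans to <-trans)

  a∈V₁ : a ∈ V₁
  a∈V₁ = proj₁ (proj₁ good)

  b∈V₁ : b ∈ V₁
  b∈V₁ = proj₁ (proj₂ (proj₁ good))

  c∈V₂ : c ∈ V₂
  c∈V₂ = proj₁ (proj₂ (proj₂ (proj₁ good)))

  d∈V₂ : d ∈ V₂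
  d∈V₂ = proj₂ (proj₂ (proj₂ (proj₁ good)))

  antichain₁ : Antichain P V₁
  antichain₁ = proj₁ (proj₁ (proj₂ good))

  antichain₂ : Antichain P V₂
  antichain₂ = proj₂ (proj₁ (proj₂ good))

  split₁₂ : Split22 P V₁ V₂
  split₁₂ = proj₁ (proj₂ (proj₂ good))

  split₂₁ : Split22 P V₂ V₁
  split₂₁ = proj₁ (proj₂ (proj₂ (proj₂ good)))

  upward : ∀ x y → x ∈ V₁ → y ∈ V₂ → x < y ⊎ Inc P x y
  upward = proj₂ (proj₂ (proj₂ (proj₂ good)))

  ∈V₁⇒∉V₂ : ∀ {x} → x ∈ V₁ → x ∉ V₂
  ∈V₁⇒∉V₂ {x} x∈V₁ x∈V₂ with upward x x x∈V₁ x∈V₂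
  ... | inj₁ x<x = irrefl refl x<x
  ... | inj₂ (x≢x , _) = x≢x refl

  V₂≮V₁ : ∀ {u t} → u ∈ V₂ → t ∈ V₁ → ¬ u < t
  V₂≮V₁ {u} {t} u∈V₂ t∈V₁ u<t with upward t u t∈V₁ u∈V₂
  ... | inj₁ t<u = asym u<t t<u
  ... | inj₂ (_ , _ , u≮t) = u≮t u<t

  <⇒∈V₂ : ∀ {u t} → u ∈ V₁ ⊎ u ∈ V₂ → t ∈ V₁ ⊎ t ∈ V₂ → u < t → t ∈ V₂
  <⇒∈V₂ _            (inj₂ t∈V₂) _   = t∈V₂
  <⇒∈V₂ (inj₁ u∈V₁) (inj₁ t∈V₁) u<t = ⊥-elim (antichain₁ _ _ u∈V₁ t∈V₁ u<t)
  <⇒∈V₂ (inj₂ u∈V₂) (inj₁ t∈V₁) u<t = ⊥-elim (V₂≮V₁ u∈V₂ t∈V₁ u<t)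

  orient : ∀ {x y z w} → x ∈ V₁ → y ∈ V₁ → z ∈ V₂ → w ∈ V₂ → x ≢ y →
    Induces22 P x y z w → ∃₂ λ r s → r ∈ V₂ × s ∈ V₂ × Is22 P x y r s
  orient {x} {y} {z} {w} x∈V₁ y∈V₁ z∈V₂ w∈V₂ x≢y (p , q , r , s , I , π) =
    pick (lower x∈V₁ (hereˡ refl)) (lower y∈V₁ (thereˡ (hereˡ refl)))
    where
    sides : All (λ e → e ∈ V₁ ⊎ e ∈ V₂) (p ∷ˡ q ∷ˡ r ∷ˡ s ∷ˡ [])
    sides = All-resp-↭ (↭-sym π) (inj₁ x∈V₁ ∷ᵃ inj₁ y∈V₁ ∷ᵃ inj₂ z∈V₂ ∷ᵃ inj₂ w∈V₂ ∷ᵃ []ᵃ)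
    r∈V₂ : r ∈ V₂
    r∈V₂ with p∈ ∷ᵃ _ ∷ᵃ r∈ ∷ᵃ _ ← sides = <⇒∈V₂ p∈ r∈ (proj₁ I)
    s∈V₂ : s ∈ V₂
    s∈V₂ with _ ∷ᵃ q∈ ∷ᵃ _ ∷ᵃ s∈ ∷ᵃ _ ← sides = <⇒∈V₂ q∈ s∈ (proj₁ (proj₂ I))
    lower : ∀ {e} → e ∈ V₁ → e ∈ˡ (x ∷ˡ y ∷ˡ z ∷ˡ w ∷ˡ []) → e ≡ p ⊎ e ≡ q
    lower e∈V₁ e∈xyzw with ∈-resp-↭ (↭-sym π) e∈xyzw
    ... | hereˡ e≡p = inj₁ e≡p
    ... | thereˡ (hereˡ e≡q) = inj₂ e≡q
    ... | thereˡ (thereˡ (hereˡ refl)) = ⊥-elim (∈V₁⇒∉V₂ e∈V₁ r∈V₂)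
    ... | thereˡ (thereˡ (thereˡ (hereˡ refl))) = ⊥-elim (∈V₁⇒∉V₂ e∈V₁ s∈V₂)
    pick : x ≡ p ⊎ x ≡ q → y ≡ p ⊎ y ≡ q → ∃₂ λ r s → r ∈ V₂ × s ∈ V₂ × Is22 P x y r s
    pick (inj₁ refl) (inj₂ refl) = r , s , r∈V₂ , s∈V₂ , I
    pick (inj₂ refl) (inj₁ refl) = s , r , s∈V₂ , r∈V₂ , Is22-swap P I
    pick (inj₁ refl) (inj₁ refl) = ⊥-elim (x≢y refl)
    pick (inj₂ refl) (inj₂ refl) = ⊥-elim (x≢y refl)

  ∃-above : a ≢ b → ∀ {x} → x ∈ V₁ → ∃ λ r → r ∈ V₂ × x < r
  ∃-above a≢b {x} x∈V₁ with split₁₂ ⁅ x ⁆ (x , x∈⁅x⁆ x) (⁅x⁆⊆V₁ , other)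
    where
    ⁅x⁆⊆V₁ : ⁅ x ⁆ ⊆ V₁
    ⁅x⁆⊆V₁ y∈⁅x⁆ rewrite x∈⁅y⁆⇒x≡y x y∈⁅x⁆ = x∈V₁
    other : ∃ λ t → t ∈ V₁ × t ∉ ⁅ x ⁆
    other with a ≟ᶠ x
    ... | yes refl = b , b∈V₁ , x≢y⇒x∉⁅y⁆ (a≢b ∘ sym)
    ... | no a≢x   = a , a∈V₁ , x≢y⇒x∉⁅y⁆ a≢x
  ... | x′ , y , z , w , x′∈⁅x⁆ , y∈V₁─⁅x⁆ , z∈V₂ , w∈V₂ , I
    with refl ← x∈⁅y⁆⇒x≡y x x′∈⁅x⁆
    with orient x∈V₁ (p─q⊆p V₁ ⁅ x ⁆ y∈V₁─⁅x⁆) z∈V₂ w∈V₂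
           (λ x≡y → x∈p─q⇒x∉q y∈V₁─⁅x⁆ (subst (_∈ ⁅ x ⁆) x≡y (x∈⁅x⁆ x))) I
  ... | r , _ , r∈V₂ , _ , (x<r , _) = r , r∈V₂ , x<r

  Good-∪⁅⁆ʳ : ∀ {v k z w} → v ∉ V₁ → v ∉ V₂ → (∀ u → u ∈ V₂ → Inc P v u) → (∀ x → x ∈ V₁ → ¬ v < x) →
    k ∈ V₂ → z ∈ V₁ → w ∈ V₁ → Is22 P z w v k → Good P a b c d V₁ (V₂ ∪ ⁅ v ⁆)
  Good-∪⁅⁆ʳ {v} {k} {z} {w} v∉V₁ v∉V₂ v∥V₂ V₁≯v k∈V₂ z∈V₁ w∈V₁ I =
    (a∈V₁ , b∈V₁ , p⊆p∪q _ c∈V₂ , p⊆p∪q _ d∈V₂) , (antichain₁ , antichain₂′) ,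
    Split22-monoʳ P (p⊆p∪q _) split₁₂ ,
    Split22-∪⁅⁆ P split₂₁ v∉V₂ k∈V₂ z∈V₁ w∈V₁
      (Induces22-resp-↭ P (++-comm (z ∷ˡ w ∷ˡ []) (v ∷ˡ k ∷ˡ [])) (Is22⇒Induces22 P I)) ,
    upward′
    where
    antichain₂′ : Antichain P (V₂ ∪ ⁅ v ⁆)
    antichain₂′ x y x∈ y∈ with x∈p∪⁅y⁆⁻ x∈ | x∈p∪⁅y⁆⁻ y∈
    ... | inj₁ x∈V₂ | inj₁ y∈V₂ = antichain₂ x y x∈V₂ y∈V₂
    ... | inj₁ x∈V₂ | inj₂ refl = proj₂ (proj₂ (v∥V₂ x x∈V₂))
    ... | inj₂ refl | inj₁ y∈V₂ = proj₁ (proj₂ (v∥V₂ y y∈V₂))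
    ... | inj₂ refl | inj₂ refl = irrefl refl
    upward′ : ∀ x y → x ∈ V₁ → y ∈ V₂ ∪ ⁅ v ⁆ → x < y ⊎ Inc P x y
    upward′ x y x∈V₁ y∈ with x∈p∪⁅y⁆⁻ y∈ | x <? v
    ... | inj₁ y∈V₂ | _       = upward x y x∈V₁ y∈V₂
    ... | inj₂ refl | yes x<v = inj₁ x<v
    ... | inj₂ refl | no x≮v  = inj₂ (x∉p∧y∈p⇒x≢y v∉V₁ x∈V₁ ∘ sym , x≮v , V₁≯v x x∈V₁)

module _ {n : ℕ} (P : FinPoset n) (no31 : ThreeOneFree P) {a b c d : Fin n} {V₁ V₂ : Subset n}
         (c≢d : c ≢ d) (maximal : MaximalGood P a b c d V₁ V₂) where
  open FinPoset P
  open IsStrictPartialOrder isSPO using () renaming (trans to <-trans)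
  open GoodPair P (proj₁ maximal)
  private module Dual = GoodPair (P ᵒᵖ) (Good-ᵒᵖ P (proj₁ maximal))

  ∃-below : ∀ {u} → u ∈ V₂ → ∃ λ p → p ∈ V₁ × p < u
  ∃-below = Dual.∃-above c≢d

  ∈V₂-by-maximality : ∀ {v} → Good P a b c d V₁ (V₂ ∪ ⁅ v ⁆) → v ∈ V₂
  ∈V₂-by-maximality {v} good′ =
    subst (v ∈_) (proj₂ (proj₂ maximal V₁ (V₂ ∪ ⁅ v ⁆) good′ id (p⊆p∪q _)))
          (q⊆p∪q V₂ ⁅ v ⁆ (x∈⁅x⁆ v))

  x<v⇒v∥V₂ : ∀ {v x y s} → v ∉ V₂ → x ∈ V₁ → y ∈ V₁ → s ∈ V₂ →
    x < v → Inc P v y → y < s → Inc P x s → ∀ u → u ∈ V₂ → Inc P v u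
  x<v⇒v∥V₂ {v} {x} {y} {s} v∉V₂ x∈V₁ y∈V₁ s∈V₂ x<v v∥y@(_ , _ , y≮v) y<s x∥s@(_ , x≮s , _) u u∈V₂ =
    v≢u , v≮u , u≮v
    where
    v≢u : v ≢ u
    v≢u = x∉p∧y∈p⇒x≢y v∉V₂ u∈V₂
    v≮s : ¬ v < s
    v≮s v<s = x≮s (<-trans x<v v<s)
    v∥s : Inc P v s
    v∥s = x∉p∧y∈p⇒x≢y v∉V₂ s∈V₂ , v≮s , λ s<v → y≮v (<-trans y<s s<v)
    v≮u : ¬ v < u
    v≮u v<u = no31 x v u s (x<v , v<u , Inc-sym P x∥s , Inc-sym P v∥s , s∥u)
      where
      s∥u : Inc P s u
      s∥u = (λ { refl → v≮s v<u }) , antichain₂ s u s∈V₂ u∈V₂ , antichain₂ u s u∈V₂ s∈V₂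
    u≮v : ¬ u < v
    u≮v u<v with p , p∈V₁ , p<u ← ∃-below u∈V₂ =
      no31 p u v y (p<u , u<v , y∥p , y∥u , Inc-sym P v∥y)
      where
      y≮u : ¬ y < u
      y≮u y<u = y≮v (<-trans y<u u<v)
      y∥p : Inc P y p
      y∥p = (λ { refl → y≮u p<u }) , antichain₁ y p y∈V₁ p∈V₁ , antichain₁ p y p∈V₁ y∈V₁
      y∥u : Inc P y u
      y∥u = x∉p∧y∈p⇒x≢y (∈V₁⇒∉V₂ y∈V₁) u∈V₂ , y≮u , V₂≮V₁ u∈V₂ y∈V₁

  Comp-x∧Inc-y⇒⊥ : ∀ {v x y r s} → v ∉ V₁ → v ∉ V₂ → x ∈ V₁ → y ∈ V₁ → s ∈ V₂ →
    Is22 P x y r s → Comp P v x → Inc P v y → ⊥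
  Comp-x∧Inc-y⇒⊥ _ _ _ _ _ (x<r , _ , x∥y , _ , y∥r , _) (inj₁ v<x) v∥y =
    no31 _ _ _ _ (v<x , x<r , Inc-sym P v∥y , Inc-sym P x∥y , y∥r)
  Comp-x∧Inc-y⇒⊥ {v} v∉V₁ v∉V₂ x∈V₁ y∈V₁ s∈V₂ (_ , y<s , x∥y , x∥s , _ , _) (inj₂ x<v) v∥y =
    v∉V₂ (∈V₂-by-maximality (Good-∪⁅⁆ʳ v∉V₁ v∉V₂ v∥V₂ V₁≯v s∈V₂ x∈V₁ y∈V₁
                              (x<v , y<s , x∥y , x∥s , Inc-sym P v∥y , v∥V₂ _ s∈V₂)))
    where
    v∥V₂ = x<v⇒v∥V₂ v∉V₂ x∈V₁ y∈V₁ s∈V₂ x<v v∥y y<s x∥s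
    V₁≯v : ∀ x′ → x′ ∈ V₁ → ¬ v < x′
    V₁≯v x′ x′∈V₁ v<x′ = antichain₁ _ x′ x∈V₁ x′∈V₁ (<-trans x<v v<x′)

  Homogeneous-V₁ : ∀ {v} → v ∉ V₁ → v ∉ V₂ → Homogeneous P v V₁
  Homogeneous-V₁ {v} v∉V₁ v∉V₂ with Split22-separates P split₁₂ (Comp? P v)
  ... | inj₁ all-comparable = inj₁ all-comparable
  ... | inj₂ (inj₁ none-comparable) =
    inj₂ λ x x∈V₁ → ¬Comp⇒Inc P (x∉p∧y∈p⇒x≢y v∉V₁ x∈V₁) (none-comparable x x∈V₁)
  ... | inj₂ (inj₂ (x , y , z , w , x∈V₁ , y∈V₁ , v∼x , v≁y , z∈V₂ , w∈V₂ , I))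
    with _ , s , _ , s∈V₂ , J ← orient x∈V₁ y∈V₁ z∈V₂ w∈V₂ (λ { refl → v≁y v∼x }) I =
    ⊥-elim (Comp-x∧Inc-y⇒⊥ v∉V₁ v∉V₂ x∈V₁ y∈V₁ s∈V₂ J v∼x
              (¬Comp⇒Inc P (x∉p∧y∈p⇒x≢y v∉V₁ y∈V₁) v≁y))

lemma5p13 : ∀ {n : ℕ} (P : FinPoset n) → ThreeOneFree P →
    (a b c d : Fin n) → Is22 P a b c d →
    (V₁ V₂ : Subset n) → MaximalGood P a b c d V₁ V₂ →
    HomogeneousPair P V₁ V₂
lemma5p13 P no31 a b c d (_ , _ , (a≢b , _) , _ , _ , (c≢d , _)) V₁ V₂ maximal v v∉V₁ v∉V₂ =
  Homogeneous-V₁ P no31 c≢d maximal v∉V₁ v∉V₂ ,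
  Homogeneous-ᵒᵖ P (Homogeneous-V₁ (P ᵒᵖ) (ThreeOneFree-ᵒᵖ P no31) a≢b (MaximalGood-ᵒᵖ P maximal) v∉V₂ v∉V₁)
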